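{- Let $\mathbb{F}$ be a field of characteristic $2$. The voltage assignment $\ell$ on $\widetilde H_3(\mathbb{F})$ described in the context is reductive, i.e. for all vertices $u,v,w$ of $\widetilde H_3(\mathbb{F})$ such that $u$ and $v$ have the same set of neighbours and $v$ is adjacent to $w$, we have $\ell(w,u)=\ell(w,v)$.
   Context: Let $V=\mathbb{F}^4$, $V^*$ its dual. $\widetilde H_3(\mathbb{F})$: vertices are pure tensors $v\otimes f\in V\otimes V^*$ with $f(v)\neq0$; $v\otimes f$ and $w\otimes g$ are adjacent iff $f(w)=g(v)=0$. Let $W=\bigwedge^2V$; fix an isomorphism $\chi:\bigwedge^4V\to\mathbb{F}$; identify $\bigwedge^2V^*$ with $W^*$ via $(f_1\wedge f_2)(v_1\wedge v_2)=f_1(v_1)f_2(v_2)-f_1(v_2)f_2(v_1)$; let $\psi:W\to W^*$ be $\psi(\hat w)(\hat v)=\chi(\hat v\wedge\hat w)$, and $\phi:\bigwedge^2V^*\to W$ the inverse of $\psi$ composed with this identification. $S_2(W)$ is the symmetric square of $W$ with product written $xy$. The voltage assignment $\ell$ (values in the additive group of $S_2(W)$) assigns to the dart from $v_1\otimes h_1$ to $v_2\otimes h_2$ the element $h_1(v_1)^{ -1}h_2(v_2)^{ -1}(v_1\wedge v_2)(h_1\wedge h_2)^\phi$. -}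

module Defs where

open import Level using (Level; _⊔_) renaming (suc to lsuc)
open import Algebra.Bundles using (CommutativeRing)
open import Data.Fin using (Fin; zero; suc; _≟_)
open import Data.Product using (_×_)
open import Relation.Nullary using (¬_; yes; no)

record Field (c ℓ : Level) : Set (lsuc (c ⊔ ℓ)) where
  field
    commutativeRing : CommutativeRing c ℓ
  open CommutativeRing commutativeRing public
  field
    0≉1     : ¬ (0# ≈ 1#)
    inv     : (x : Carrier) → ¬ (x ≈ 0#) → Carrier
    inverse : (x : Carrier) (p : ¬ (x ≈ 0#)) → x * inv x p ≈ 1#

module _ {c ℓ : Level} (F : Field c ℓ) where
  open Field F hiding (zero)

  Char2 : Set ℓ
  Char2 = 1# + 1# ≈ 0#

  -- V = F^4 and V^* = F^4 (coordinates w.r.t. the standard basis e0..e3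
  -- and its dual basis); f(v) = Σ f_i v_i.
  V : Set c
  V = Fin 4 → Carrier

  V* : Set c
  V* = Fin 4 → Carrier

  ev : V* → V → Carrier
  ev f v = f zero * v zero + f (suc zero) * v (suc zero)
         + f (suc (suc zero)) * v (suc (suc zero))
         + f (suc (suc (suc zero))) * v (suc (suc (suc zero)))

  -- W = ∧²V, coordinates w.r.t. the basis e_i ∧ e_j (i < j), indexed by
  -- Fin 6 in the order 01, 02, 03, 12, 13, 23.
  W : Set c
  W = Fin 6 → Carrier

  -- W^*, represented by the values on the basis e_i ∧ e_j of W.
  W* : Set c
  W* = Fin 6 → Carrier

  fst snd : Fin 6 → Fin 4
  fst zero = zero
  fst (suc zero) = zero
  fst (suc (suc zero)) = zero
  fst (suc (suc (suc zero))) = suc zero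
  fst (suc (suc (suc (suc zero)))) = suc zero
  fst (suc (suc (suc (suc (suc zero))))) = suc (suc zero)
  snd zero = suc zero
  snd (suc zero) = suc (suc zero)
  snd (suc (suc zero)) = suc (suc (suc zero))
  snd (suc (suc (suc zero))) = suc (suc zero)
  snd (suc (suc (suc (suc zero)))) = suc (suc (suc zero))
  snd (suc (suc (suc (suc (suc zero))))) = suc (suc (suc zero))

  wedgeV : V → V → W
  wedgeV v₁ v₂ k = v₁ (fst k) * v₂ (snd k) - v₁ (snd k) * v₂ (fst k)

  -- f₁ ∧ f₂ ∈ ∧²V^*, identified with an element of W^* via
  -- (f₁ ∧ f₂)(v₁ ∧ v₂) = f₁(v₁) f₂(v₂) - f₁(v₂) f₂(v₁);
  -- its value on the basis vector e_i ∧ e_j is f₁_i f₂_j - f₁_j f₂_i.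
  wedgeV* : V* → V* → W*
  wedgeV* f₁ f₂ k = f₁ (fst k) * f₂ (snd k) - f₁ (snd k) * f₂ (fst k)

  -- The product ∧²V × ∧²V → ∧⁴V, expressed in the basis
  -- e0∧e1∧e2∧e3 of ∧⁴V (i.e. the coefficient of e0∧e1∧e2∧e3).
  wedgeW : W → W → Carrier
  wedgeW x y =
      x zero * y (suc (suc (suc (suc (suc zero)))))          -- e01 ∧ e23 = +
    - x (suc zero) * y (suc (suc (suc (suc zero))))          -- e02 ∧ e13 = -
    + x (suc (suc zero)) * y (suc (suc (suc zero)))          -- e03 ∧ e12 = +
    + x (suc (suc (suc zero))) * y (suc (suc zero))          -- e12 ∧ e03 = +
    - x (suc (suc (suc (suc zero)))) * y (suc zero)          -- e13 ∧ e02 = -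
    + x (suc (suc (suc (suc (suc zero))))) * y zero          -- e23 ∧ e01 = +

  -- An isomorphism χ : ∧⁴V → F is determined by the nonzero scalar
  -- χ₀ = χ(e0∧e1∧e2∧e3).  ψ : W → W^*, ψ(ŵ)(v̂) = χ(v̂ ∧ ŵ), represented
  -- by its values on the basis of W.
  ψ : Carrier → W → W*
  ψ χ₀ ŵ k = χ₀ * wedgeW (basisW k) ŵ
    where
    basisW : Fin 6 → W
    basisW k l with k ≟ l
    ... | yes _ = 1#
    ... | no  _ = 0#

  IsInverseOfψ : Carrier → (W* → W) → Set (c ⊔ ℓ)
  IsInverseOfψ χ₀ φ = (α : W*) (k : Fin 6) → ψ χ₀ (φ α) k ≈ α k

  -- The symmetric square S₂(W), in coordinates w.r.t. the monomial basis
  -- w_a w_b (a ≤ b) of S₂(W); we store the coefficient of w_a w_b at both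
  -- (a , b) and (b , a).
  S₂ : Set c
  S₂ = Fin 6 → Fin 6 → Carrier

  _≈S_ : S₂ → S₂ → Set ℓ
  s ≈S t = (a b : Fin 6) → s a b ≈ t a b

  symProd : W → W → S₂
  symProd x y a b with a ≟ b
  ... | yes _ = x a * y a
  ... | no  _ = x a * y b + x b * y a

  _·S_ : Carrier → S₂ → S₂
  (λ₀ ·S s) a b = λ₀ * s a b

  -- The graph H̃₃(F).  A vertex is a pure tensor v ⊗ f with f(v) ≠ 0,
  -- represented by the pair (v , f).  (Both adjacency and the voltage
  -- below are invariant under (v , f) ↦ (λv , λ⁻¹f).)
  record Vertex : Set (c ⊔ ℓ) where
    constructor vertex
    field
      vec : V
      cov : V*
      nz  : ¬ (ev cov vec ≈ 0#)
  open Vertex public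

  Adj : Vertex → Vertex → Set ℓ
  Adj u w = (ev (cov u) (vec w) ≈ 0#) × (ev (cov w) (vec u) ≈ 0#)

  SameNeighbours : Vertex → Vertex → Set (c ⊔ ℓ)
  SameNeighbours u v =
    (x : Vertex) → (Adj u x → Adj v x) × (Adj v x → Adj u x)

  voltage : (φ : W* → W) → Vertex → Vertex → S₂
  voltage φ u w =
    (inv (ev (cov u) (vec u)) (nz u) * inv (ev (cov w) (vec w)) (nz w))
      ·S symProd (wedgeV (vec u) (vec w)) (φ (wedgeV* (cov u) (cov w)))

  Reductive : (φ : W* → W) → Set (c ⊔ ℓ)
  Reductive φ = (u v w : Vertex) → SameNeighbours u v → Adj v w →
                voltage φ w u ≈S voltage φ w v

module Submission where

-- If u = v ⊗ f and u' = v' ⊗ f' have the same neighbours and w = a ⊗ g is a common neighbour,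
-- then every functional h with h(v) = 0 also kills v': shearing g by h produces a neighbour
-- (a, g') of u whose adjacency to u' forces h(v') = 0.  Hence v' = λv, and by the symmetry
-- v ⊗ f ↦ f ⊗ v of the graph also f' = μf.  The voltage ℓ(w, ·) does not see such a rescaling:
-- (a ∧ λv)(g ∧ μf)^φ = λμ (a ∧ v)(g ∧ f)^φ, while (μf)(λv) = λμ f(v).

open import Defs
open import Level using (Level; 0ℓ)
open import Function using (_∘_; id)
open import Relation.Nullary using (¬_; yes; no)
open import Data.Bool using (Bool; true; false; _xor_; _∧_)
open import Data.Maybe using (just; nothing)
open import Data.Fin using (Fin; _≟_; opposite)
open import Data.Fin.Patterns using (0F; 1F; 2F; 3F; 4F; 5F)
open import Data.Product using (Σ; _,_; proj₁; proj₂)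
open import Algebra.Bundles using (RawRing)
open import Algebra.Solver.Ring.AlmostCommutativeRing
  using (fromCommutativeRing; _-Raw-AlmostCommutative⟶_; Induced-equivalence)
open import Relation.Binary.PropositionalEquality using (_≡_)
open import Relation.Binary.Definitions using (WeaklyDecidable)

𝔽₂ : RawRing 0ℓ 0ℓ
𝔽₂ = record
  { Carrier = Bool ; _≈_ = _≡_ ; _+_ = _xor_ ; _*_ = _∧_ ; -_ = id ; 0# = false ; 1# = true }

module FieldProperties {c ℓ : Level} (F : Field c ℓ) where
  open Field F
  open import Relation.Binary.Reasoning.Setoid setoid

  inverseˡ : ∀ x (x≉0 : ¬ x ≈ 0#) → inv x x≉0 * x ≈ 1#
  inverseˡ x x≉0 = trans (*-comm _ _) (inverse x x≉0)

  *-cancelˡ-nonzero : ∀ {x y z} → ¬ x ≈ 0# → x * y ≈ x * z → y ≈ z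
  *-cancelˡ-nonzero {x} {y} {z} x≉0 xy≈xz = begin
    y                  ≈⟨ sym (*-identityˡ y) ⟩
    1# * y             ≈⟨ *-congʳ (sym (inverseˡ x x≉0)) ⟩
    (inv x x≉0 * x) * y ≈⟨ *-assoc _ _ _ ⟩
    inv x x≉0 * (x * y) ≈⟨ *-congˡ xy≈xz ⟩
    inv x x≉0 * (x * z) ≈⟨ sym (*-assoc _ _ _) ⟩
    (inv x x≉0 * x) * z ≈⟨ *-congʳ (inverseˡ x x≉0) ⟩
    1# * z             ≈⟨ *-identityˡ z ⟩
    z                  ∎

  x*y≈z⇒y≈x⁻¹*z : ∀ {x y z} (x≉0 : ¬ x ≈ 0#) → x * y ≈ z → y ≈ inv x x≉0 * z
  x*y≈z⇒y≈x⁻¹*z {x} {y} {z} x≉0 xy≈z = *-cancelˡ-nonzero x≉0 (begin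
    x * y                ≈⟨ xy≈z ⟩
    z                    ≈⟨ sym (*-identityˡ z) ⟩
    1# * z               ≈⟨ *-congʳ (sym (inverse x x≉0)) ⟩
    (x * inv x x≉0) * z  ≈⟨ *-assoc _ _ _ ⟩
    x * (inv x x≉0 * z)  ∎)

  inv-scale : ∀ {x y c} (x≉0 : ¬ x ≈ 0#) (y≉0 : ¬ y ≈ 0#) → y ≈ c * x → inv y y≉0 * c ≈ inv x x≉0
  inv-scale {x} {y} {c} x≉0 y≉0 y≈cx = sym (x*y≈z⇒y≈x⁻¹*z y≉0 (begin
    y * inv x x≉0        ≈⟨ *-congʳ y≈cx ⟩
    (c * x) * inv x x≉0  ≈⟨ *-assoc _ _ _ ⟩
    c * (x * inv x x≉0)  ≈⟨ *-congˡ (inverse x x≉0) ⟩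
    c * 1#               ≈⟨ *-identityʳ c ⟩
    c                    ∎))

  *-zero-cancelˡ : ∀ {x y} → ¬ x ≈ 0# → x * y ≈ 0# → y ≈ 0#
  *-zero-cancelˡ {x} x≉0 xy≈0 = *-cancelˡ-nonzero x≉0 (trans xy≈0 (sym (zeroʳ x)))

-- In characteristic 2 the prime field is 𝔽₂, so the ring solver can run with Boolean coefficients.
module Char2Solver {c ℓ : Level} (F : Field c ℓ) (char2 : Char2 F) where
  open Field F
  open import Algebra.Properties.Ring ring using (-0#≈0#)
  open import Algebra.Properties.Group +-group using (inverseʳ-unique)

  ⟦_⟧ : Bool → Carrier
  ⟦ true ⟧ = 1#
  ⟦ false ⟧ = 0#

  homomorphism : 𝔽₂ -Raw-AlmostCommutative⟶ fromCommutativeRing commutativeRing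
  homomorphism = record
    { ⟦_⟧ = ⟦_⟧ ; +-homo = +-homo ; *-homo = *-homo ; -‿homo = -‿homo ; 0-homo = refl ; 1-homo = refl }
    where
    +-homo : ∀ a b → ⟦ a xor b ⟧ ≈ ⟦ a ⟧ + ⟦ b ⟧
    +-homo true  true  = sym char2
    +-homo true  false = sym (+-identityʳ 1#)
    +-homo false b     = sym (+-identityˡ ⟦ b ⟧)
    *-homo : ∀ a b → ⟦ a ∧ b ⟧ ≈ ⟦ a ⟧ * ⟦ b ⟧
    *-homo true  b = sym (*-identityˡ ⟦ b ⟧)
    *-homo false b = sym (zeroˡ ⟦ b ⟧)
    -‿homo : ∀ a → ⟦ a ⟧ ≈ - ⟦ a ⟧
    -‿homo true  = inverseʳ-unique 1# 1# char2
    -‿homo false = sym -0#≈0#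

  decide : WeaklyDecidable (Induced-equivalence homomorphism)
  decide true  true  = just refl
  decide false false = just refl
  decide _     _     = nothing

  open import Algebra.Solver.Ring 𝔽₂ (fromCommutativeRing commutativeRing) homomorphism decide public
    using (Polynomial; solve; _:=_; _:+_; _:*_; _:-_; con)

module Reductivity {c ℓ : Level} (F : Field c ℓ) (char2 : Char2 F) where
  open Field F
  open FieldProperties F
  open Char2Solver F char2
  open import Relation.Binary.Reasoning.Setoid setoid
  open import Algebra.Properties.Group +-group using (x∙y⁻¹≈ε⇒x≈y)
  open import Algebra.Properties.CommutativeSemigroup *-commutativeSemigroup using (x∙yz≈y∙xz)

  ⟨_,_⟩ : V* F → V F → Carrier
  ⟨ f , x ⟩ = ev F f x

  _·_ : ∀ {n} → Carrier → (Fin n → Carrier) → Fin n → Carrier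
  (λ₀ · x) k = λ₀ * x k

  δ : Fin 4 → V* F
  δ k j with k ≟ j
  ... | yes _ = 1#
  ... | no  _ = 0#

  private
    𝟘 𝟙 : ∀ {n} → Polynomial n
    𝟘 = con false
    𝟙 = con true

    evₚ : ∀ {n} → (f₀ f₁ f₂ f₃ x₀ x₁ x₂ x₃ : Polynomial n) → Polynomial n
    evₚ f₀ f₁ f₂ f₃ x₀ x₁ x₂ x₃ = f₀ :* x₀ :+ f₁ :* x₁ :+ f₂ :* x₂ :+ f₃ :* x₃

  ev-comm : ∀ f x → ⟨ f , x ⟩ ≈ ⟨ x , f ⟩
  ev-comm f x =
    solve 8 (λ f₀ f₁ f₂ f₃ x₀ x₁ x₂ x₃ →
               evₚ f₀ f₁ f₂ f₃ x₀ x₁ x₂ x₃ := evₚ x₀ x₁ x₂ x₃ f₀ f₁ f₂ f₃)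
          refl (f 0F) (f 1F) (f 2F) (f 3F) (x 0F) (x 1F) (x 2F) (x 3F)

  ev-linearˡ : ∀ α β g h x →
               ⟨ (λ j → α * g j - β * h j) , x ⟩ ≈ α * ⟨ g , x ⟩ - β * ⟨ h , x ⟩
  ev-linearˡ α β g h x =
    solve 14 (λ α β g₀ g₁ g₂ g₃ h₀ h₁ h₂ h₃ x₀ x₁ x₂ x₃ →
                evₚ (α :* g₀ :- β :* h₀) (α :* g₁ :- β :* h₁)
                    (α :* g₂ :- β :* h₂) (α :* g₃ :- β :* h₃) x₀ x₁ x₂ x₃
                := α :* evₚ g₀ g₁ g₂ g₃ x₀ x₁ x₂ x₃ :- β :* evₚ h₀ h₁ h₂ h₃ x₀ x₁ x₂ x₃)
          refl α β (g 0F) (g 1F) (g 2F) (g 3F) (h 0F) (h 1F) (h 2F) (h 3F)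
          (x 0F) (x 1F) (x 2F) (x 3F)

  ev-scale : ∀ λ₀ μ f x → ⟨ μ · f , λ₀ · x ⟩ ≈ (λ₀ * μ) * ⟨ f , x ⟩
  ev-scale λ₀ μ f x =
    solve 10 (λ λ₀ μ f₀ f₁ f₂ f₃ x₀ x₁ x₂ x₃ →
                evₚ (μ :* f₀) (μ :* f₁) (μ :* f₂) (μ :* f₃)
                    (λ₀ :* x₀) (λ₀ :* x₁) (λ₀ :* x₂) (λ₀ :* x₃)
                := (λ₀ :* μ) :* evₚ f₀ f₁ f₂ f₃ x₀ x₁ x₂ x₃)
          refl λ₀ μ (f 0F) (f 1F) (f 2F) (f 3F) (x 0F) (x 1F) (x 2F) (x 3F)

  ev-δ : ∀ k x → ⟨ δ k , x ⟩ ≈ x k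
  ev-δ 0F x = solve 4 (λ x₀ x₁ x₂ x₃ → evₚ 𝟙 𝟘 𝟘 𝟘 x₀ x₁ x₂ x₃ := x₀) refl (x 0F) (x 1F) (x 2F) (x 3F)
  ev-δ 1F x = solve 4 (λ x₀ x₁ x₂ x₃ → evₚ 𝟘 𝟙 𝟘 𝟘 x₀ x₁ x₂ x₃ := x₁) refl (x 0F) (x 1F) (x 2F) (x 3F)
  ev-δ 2F x = solve 4 (λ x₀ x₁ x₂ x₃ → evₚ 𝟘 𝟘 𝟙 𝟘 x₀ x₁ x₂ x₃ := x₂) refl (x 0F) (x 1F) (x 2F) (x 3F)
  ev-δ 3F x = solve 4 (λ x₀ x₁ x₂ x₃ → evₚ 𝟘 𝟘 𝟘 𝟙 x₀ x₁ x₂ x₃ := x₃) refl (x 0F) (x 1F) (x 2F) (x 3F)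

  ev-cong : ∀ {f f' x x'} → (∀ j → f j ≈ f' j) → (∀ j → x j ≈ x' j) → ⟨ f , x ⟩ ≈ ⟨ f' , x' ⟩
  ev-cong f≈f' x≈x' = +-cong (+-cong (+-cong (*-cong (f≈f' 0F) (x≈x' 0F))
    (*-cong (f≈f' 1F) (x≈x' 1F))) (*-cong (f≈f' 2F) (x≈x' 2F))) (*-cong (f≈f' 3F) (x≈x' 3F))

  transpose : Vertex F → Vertex F
  transpose (vertex v f f[v]≉0) = vertex f v (f[v]≉0 ∘ trans (ev-comm f v))

  Adj-transpose : ∀ u w → Adj F u w → Adj F (transpose u) (transpose w)
  Adj-transpose u w (f[x]≈0 , g[v]≈0) =
    trans (ev-comm (vec u) (cov w)) g[v]≈0 , trans (ev-comm (vec w) (cov u)) f[x]≈0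

  SameNeighbours-transpose : ∀ {u u'} → SameNeighbours F u u' →
                             SameNeighbours F (transpose u) (transpose u')
  SameNeighbours-transpose {u} {u'} sn x =
    Adj-transpose u' (transpose x) ∘ proj₁ (sn (transpose x)) ∘ Adj-transpose (transpose u) x ,
    Adj-transpose u (transpose x) ∘ proj₂ (sn (transpose x)) ∘ Adj-transpose (transpose u') x

  -- g' = g(a)·h − (h(a) − 1)·g takes the value g(a) at a, and at every zero of g it is g(a)·h;
  -- so (a, g') is a vertex, adjacent to u precisely when h(v) = 0.
  sameNeighbours⇒annihilator-⊆ : ∀ {u u' w} → SameNeighbours F u u' → Adj F u' w →
                                 ∀ h → ⟨ h , vec u ⟩ ≈ 0# → ⟨ h , vec u' ⟩ ≈ 0#
  sameNeighbours⇒annihilator-⊆ {u} {u'} {w@(vertex a g g[a]≉0)} sn u'~w@(_ , g[v']≈0) h h[v]≈0 =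
    *-zero-cancelˡ g[a]≉0 (trans (sym (g'-at (vec u') g[v']≈0)) g'[v']≈0)
    where
    g' : V* F
    g' j = ⟨ g , a ⟩ * h j - (⟨ h , a ⟩ - 1#) * g j

    g'-at : ∀ x → ⟨ g , x ⟩ ≈ 0# → ⟨ g' , x ⟩ ≈ ⟨ g , a ⟩ * ⟨ h , x ⟩
    g'-at x g[x]≈0 = begin
      ⟨ g' , x ⟩
        ≈⟨ ev-linearˡ ⟨ g , a ⟩ (⟨ h , a ⟩ - 1#) h g x ⟩
      ⟨ g , a ⟩ * ⟨ h , x ⟩ - (⟨ h , a ⟩ - 1#) * ⟨ g , x ⟩
        ≈⟨ +-congˡ (-‿cong (*-congˡ g[x]≈0)) ⟩
      ⟨ g , a ⟩ * ⟨ h , x ⟩ - (⟨ h , a ⟩ - 1#) * 0#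
        ≈⟨ solve 3 (λ G H A → G :* H :- (A :- 𝟙) :* 𝟘 := G :* H) refl ⟨ g , a ⟩ ⟨ h , x ⟩ ⟨ h , a ⟩ ⟩
      ⟨ g , a ⟩ * ⟨ h , x ⟩
        ∎

    g'[a]≈g[a] : ⟨ g' , a ⟩ ≈ ⟨ g , a ⟩
    g'[a]≈g[a] = trans (ev-linearˡ ⟨ g , a ⟩ (⟨ h , a ⟩ - 1#) h g a)
      (solve 2 (λ G H → G :* H :- (H :- 𝟙) :* G := G) refl ⟨ g , a ⟩ ⟨ h , a ⟩)

    x : Vertex F
    x = vertex a g' (g[a]≉0 ∘ trans (sym g'[a]≈g[a]))

    u~w : Adj F u w
    u~w = proj₂ (sn w) u'~w

    u~x : Adj F u x
    u~x = proj₁ u~w , trans (g'-at (vec u) (proj₂ u~w)) (trans (*-congˡ h[v]≈0) (zeroʳ _))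

    g'[v']≈0 : ⟨ g' , vec u' ⟩ ≈ 0#
    g'[v']≈0 = proj₂ (proj₁ (sn x) u~x)

  annihilator-⊆⇒proportional : ∀ {v v'} → (∀ h → ⟨ h , v ⟩ ≈ 0# → ⟨ h , v' ⟩ ≈ 0#) →
                               ∀ f k → ⟨ f , v ⟩ * v' k ≈ ⟨ f , v' ⟩ * v k
  annihilator-⊆⇒proportional {v} {v'} ann⊆ f k =
    trans (x∙y⁻¹≈ε⇒x≈y _ _ (trans (sym (h-at v')) (ann⊆ h h[v]≈0))) (*-comm (v k) ⟨ f , v' ⟩)
    where
    h : V* F
    h j = ⟨ f , v ⟩ * δ k j - v k * f j

    h-at : ∀ x → ⟨ h , x ⟩ ≈ ⟨ f , v ⟩ * x k - v k * ⟨ f , x ⟩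
    h-at x = trans (ev-linearˡ ⟨ f , v ⟩ (v k) (δ k) f x) (+-congʳ (*-congˡ (ev-δ k x)))

    h[v]≈0 : ⟨ h , v ⟩ ≈ 0#
    h[v]≈0 = trans (h-at v) (solve 2 (λ r y → r :* y :- y :* r := 𝟘) refl ⟨ f , v ⟩ (v k))

  sameNeighbours⇒vec-multiple : ∀ {u u' w} → SameNeighbours F u u' → Adj F u' w →
                                Σ Carrier λ λ₀ → ∀ k → vec u' k ≈ λ₀ * vec u k
  sameNeighbours⇒vec-multiple {u@(vertex v f f[v]≉0)} {u'} {w} sn u'~w =
    inv ⟨ f , v ⟩ f[v]≉0 * ⟨ f , vec u' ⟩ , λ k →
      trans (x*y≈z⇒y≈x⁻¹*z f[v]≉0 (annihilator-⊆⇒proportional {v} {vec u'} ann⊆ f k)) (sym (*-assoc _ _ _))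
    where
    ann⊆ : ∀ h → ⟨ h , v ⟩ ≈ 0# → ⟨ h , vec u' ⟩ ≈ 0#
    ann⊆ = sameNeighbours⇒annihilator-⊆ {u} {u'} {w} sn u'~w

  sameNeighbours⇒cov-multiple : ∀ {u u' w} → SameNeighbours F u u' → Adj F u' w →
                                Σ Carrier λ μ → ∀ k → cov u' k ≈ μ * cov u k
  sameNeighbours⇒cov-multiple {u} {u'} {w} sn u'~w =
    sameNeighbours⇒vec-multiple {transpose u} {transpose u'} {transpose w}
      (SameNeighbours-transpose {u} {u'} sn) (Adj-transpose u' w u'~w)

  private
    wedgeWₚ : ∀ {n} → (x₀ x₁ x₂ x₃ x₄ x₅ y₀ y₁ y₂ y₃ y₄ y₅ : Polynomial n) → Polynomial n
    wedgeWₚ x₀ x₁ x₂ x₃ x₄ x₅ y₀ y₁ y₂ y₃ y₄ y₅ =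
      x₀ :* y₅ :- x₁ :* y₄ :+ x₂ :* y₃ :+ x₃ :* y₂ :- x₄ :* y₁ :+ x₅ :* y₀

  -- opposite k indexes the pair complementary to k (01↔23, 02↔13, 03↔12); in characteristic 2
  -- the signs of the pairing ∧²V × ∧²V → ∧⁴V disappear.
  ψ-opposite : ∀ χ₀ y k → ψ F χ₀ y (opposite k) ≈ χ₀ * y k
  ψ-opposite χ₀ y 0F = *-congˡ
    (solve 6 (λ y₀ y₁ y₂ y₃ y₄ y₅ → wedgeWₚ 𝟘 𝟘 𝟘 𝟘 𝟘 𝟙 y₀ y₁ y₂ y₃ y₄ y₅ := y₀)
           refl (y 0F) (y 1F) (y 2F) (y 3F) (y 4F) (y 5F))
  ψ-opposite χ₀ y 1F = *-congˡ
    (solve 6 (λ y₀ y₁ y₂ y₃ y₄ y₅ → wedgeWₚ 𝟘 𝟘 𝟘 𝟘 𝟙 𝟘 y₀ y₁ y₂ y₃ y₄ y₅ := y₁)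
           refl (y 0F) (y 1F) (y 2F) (y 3F) (y 4F) (y 5F))
  ψ-opposite χ₀ y 2F = *-congˡ
    (solve 6 (λ y₀ y₁ y₂ y₃ y₄ y₅ → wedgeWₚ 𝟘 𝟘 𝟘 𝟙 𝟘 𝟘 y₀ y₁ y₂ y₃ y₄ y₅ := y₂)
           refl (y 0F) (y 1F) (y 2F) (y 3F) (y 4F) (y 5F))
  ψ-opposite χ₀ y 3F = *-congˡ
    (solve 6 (λ y₀ y₁ y₂ y₃ y₄ y₅ → wedgeWₚ 𝟘 𝟘 𝟙 𝟘 𝟘 𝟘 y₀ y₁ y₂ y₃ y₄ y₅ := y₃)
           refl (y 0F) (y 1F) (y 2F) (y 3F) (y 4F) (y 5F))
  ψ-opposite χ₀ y 4F = *-congˡ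
    (solve 6 (λ y₀ y₁ y₂ y₃ y₄ y₅ → wedgeWₚ 𝟘 𝟙 𝟘 𝟘 𝟘 𝟘 y₀ y₁ y₂ y₃ y₄ y₅ := y₄)
           refl (y 0F) (y 1F) (y 2F) (y 3F) (y 4F) (y 5F))
  ψ-opposite χ₀ y 5F = *-congˡ
    (solve 6 (λ y₀ y₁ y₂ y₃ y₄ y₅ → wedgeWₚ 𝟙 𝟘 𝟘 𝟘 𝟘 𝟘 y₀ y₁ y₂ y₃ y₄ y₅ := y₅)
           refl (y 0F) (y 1F) (y 2F) (y 3F) (y 4F) (y 5F))

  wedgeV-scaleʳ : ∀ {λ₀ x y y'} → (∀ i → y' i ≈ λ₀ * y i) →
                  ∀ k → wedgeV F x y' k ≈ λ₀ * wedgeV F x y k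
  wedgeV-scaleʳ {λ₀} {x} {y} y'≈λy k =
    trans (+-cong (*-congˡ (y'≈λy (snd F k))) (-‿cong (*-congˡ (y'≈λy (fst F k)))))
          (solve 5 (λ λ₀ a b c d → a :* (λ₀ :* b) :- c :* (λ₀ :* d) := λ₀ :* (a :* b :- c :* d))
                 refl λ₀ (x (fst F k)) (y (snd F k)) (x (snd F k)) (y (fst F k)))

  symProd-scale : ∀ {λ₀ μ x x' y y'} → (∀ i → x' i ≈ λ₀ * x i) → (∀ i → y' i ≈ μ * y i) →
                  ∀ a b → symProd F x' y' a b ≈ (λ₀ * μ) * symProd F x y a b
  symProd-scale {λ₀} {μ} {x} {x'} {y} {y'} x'≈λx y'≈μy a b with a ≟ b
  ... | yes _ = trans (*-cong (x'≈λx a) (y'≈μy a))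
                      (solve 4 (λ l m p q → (l :* p) :* (m :* q) := (l :* m) :* (p :* q))
                             refl λ₀ μ (x a) (y a))
  ... | no  _ = trans (+-cong (*-cong (x'≈λx a) (y'≈μy b)) (*-cong (x'≈λx b) (y'≈μy a)))
                      (solve 6 (λ l m p q r s → (l :* p) :* (m :* q) :+ (l :* r) :* (m :* s)
                                                := (l :* m) :* (p :* q :+ r :* s))
                             refl λ₀ μ (x a) (y b) (x b) (y a))

  module _ {χ₀ : Carrier} (χ₀≉0 : ¬ χ₀ ≈ 0#) (φ : W* F → W F) (ψφ≈id : IsInverseOfψ F χ₀ φ) where

    φ-scale : ∀ {μ β β'} → (∀ m → β' m ≈ μ * β m) → ∀ j → φ β' j ≈ μ * φ β j
    φ-scale {μ} {β} {β'} β'≈μβ j = *-cancelˡ-nonzero χ₀≉0 (begin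
      χ₀ * φ β' j                    ≈⟨ ψ-opposite χ₀ (φ β') j ⟨
      ψ F χ₀ (φ β') (opposite j)     ≈⟨ ψφ≈id β' (opposite j) ⟩
      β' (opposite j)                ≈⟨ β'≈μβ (opposite j) ⟩
      μ * β (opposite j)             ≈⟨ *-congˡ (ψφ≈id β (opposite j)) ⟨
      μ * ψ F χ₀ (φ β) (opposite j)  ≈⟨ *-congˡ (ψ-opposite χ₀ (φ β) j) ⟩
      μ * (χ₀ * φ β j)               ≈⟨ x∙yz≈y∙xz μ χ₀ (φ β j) ⟩
      χ₀ * (μ * φ β j)               ∎)

    -- wedgeV-scaleʳ applies to wedgeV* too: both have the same defining equation.
    voltage-scale-invariant : ∀ w u u' {λ₀ μ} →
                              (∀ k → vec u' k ≈ λ₀ * vec u k) → (∀ k → cov u' k ≈ μ * cov u k) →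
                              _≈S_ F (voltage F φ w u) (voltage F φ w u')
    voltage-scale-invariant (vertex a g g[a]≉0) (vertex v f f[v]≉0)
                            (vertex v' f' f'[v']≉0) {λ₀} {μ} v'≈λv f'≈μf i j = sym (begin
      (G⁻¹ * R'⁻¹) * S'
        ≈⟨ *-congˡ (symProd-scale (wedgeV-scaleʳ {x = a} v'≈λv)
                     (φ-scale {β = wedgeV* F g f} (wedgeV-scaleʳ {x = g} f'≈μf)) i j) ⟩
      (G⁻¹ * R'⁻¹) * ((λ₀ * μ) * S)
        ≈⟨ solve 4 (λ p q r s → (p :* q) :* (r :* s) := (p :* (q :* r)) :* s) refl G⁻¹ R'⁻¹ (λ₀ * μ) S ⟩
      (G⁻¹ * (R'⁻¹ * (λ₀ * μ))) * S
        ≈⟨ *-congʳ (*-congˡ (inv-scale f[v]≉0 f'[v']≉0 R'≈λμR)) ⟩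
      (G⁻¹ * R⁻¹) * S
        ∎)
      where
      G⁻¹  = inv ⟨ g , a ⟩ g[a]≉0
      R⁻¹  = inv ⟨ f , v ⟩ f[v]≉0
      R'⁻¹ = inv ⟨ f' , v' ⟩ f'[v']≉0
      S  = symProd F (wedgeV F a v) (φ (wedgeV* F g f)) i j
      S' = symProd F (wedgeV F a v') (φ (wedgeV* F g f')) i j
      R'≈λμR : ⟨ f' , v' ⟩ ≈ (λ₀ * μ) * ⟨ f , v ⟩
      R'≈λμR = trans (ev-cong f'≈μf v'≈λv) (ev-scale λ₀ μ f v)

lemma3p7 : {c ℓ : Level} (F : Field c ℓ) → Char2 F →
           (χ₀ : Field.Carrier F) → ¬ (Field._≈_ F χ₀ (Field.0# F)) →
           (φ : W* F → W F) → IsInverseOfψ F χ₀ φ →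
           Reductive F φ
lemma3p7 F char2 χ₀ χ₀≉0 φ ψφ≈id u u' w sn u'~w =
  voltage-scale-invariant χ₀≉0 φ ψφ≈id w u u' v'≈λv f'≈μf
  where
  open Reductivity F char2
  v'≈λv = proj₂ (sameNeighbours⇒vec-multiple {u} {u'} {w} sn u'~w)
  f'≈μf = proj₂ (sameNeighbours⇒cov-multiple {u} {u'} {w} sn u'~w)
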